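{- Let $m,n\geq 2$ and $k,r$ be positive integers with $k\mid r$. Then $\alpha\left(\Gamma^k_{m,n}(r)\right)=\max\{r,\tfrac{nr}{k}\}$.
   Context: $[t]=\{1,\dots,t\}$. Fix a partition $\pi=\{P_1,\dots,P_k\}$ of $[r]$ into $k$ parts of equal size. The graph $\Gamma^k_{m,n}(r)$ has vertex set $\{(a,b,c):a\in[r],b\in[m],c\in[n]\}$, and $(a,b,c)\sim(a',b',c')$ iff either ($c=c'$ and $b\neq b'$) or ($c\neq c'$ and $a,a'$ lie in different parts of $\pi$). $\alpha(X)$ denotes the independence number (maximum size of a set of pairwise non-adjacent vertices). -}

module Defs where

open import Data.Nat using (ℕ; _⊔_; _*_; _≤_)
open import Data.Fin using (Fin; _≟_)
open import Data.Fin.Properties using () renaming (_≟_ to _≟ᶠ_)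
open import Data.Product using (_×_; _,_; Σ; ∃)
open import Data.Sum using (_⊎_)
open import Data.List using (List; length; filter; allFin)
open import Data.List.Relation.Unary.Unique.Propositional using (Unique)
open import Data.List.Membership.Propositional using (_∈_)
open import Relation.Binary.PropositionalEquality using (_≡_; _≢_)
open import Relation.Nullary using (¬_)

-- A partition of [r] into k parts, given by the part-assignment map.
-- "Equal size": every part P_i = {a | part a ≡ i} has exactly s elements
-- (every part is nonempty automatically when s ≥ 1).
PartSize : ∀ {r k} → (Fin r → Fin k) → Fin k → ℕ
PartSize {r} part i = length (filter (λ a → part a ≟ i) (allFin r))

EqualPartition : (r k : ℕ) → (Fin r → Fin k) → ℕ → Set
EqualPartition r k part s = ∀ (i : Fin k) → PartSize part i ≡ s

Vertex : ℕ → ℕ → ℕ → Set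
Vertex r m n = Fin r × Fin m × Fin n

Adj : ∀ {r k m n} → (Fin r → Fin k) → Vertex r m n → Vertex r m n → Set
Adj part (a , b , c) (a' , b' , c') =
  (c ≡ c' × b ≢ b') ⊎ (c ≢ c' × part a ≢ part a')

IsIndependent : ∀ {r k m n} → (Fin r → Fin k) → List (Vertex r m n) → Set
IsIndependent {r} {k} {m} {n} part S =
  Unique S × (∀ {x y : Vertex r m n} → x ∈ S → y ∈ S → ¬ Adj {r} {k} {m} {n} part x y)

IndependenceNumberIs : ∀ {r k} → (Fin r → Fin k) → (m n : ℕ) → ℕ → Set
IndependenceNumberIs {r} {k} part m n N =
  Σ (List (Vertex r m n)) (λ S → IsIndependent part S × length S ≡ N)
  × (∀ (S : List (Vertex r m n)) → IsIndependent part S → length S ≤ N)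

-- An independent set either lies in a single column c (then the vertices share one b,
-- so a ↦ (a, b, c) is injective and there are at most r of them), or it meets two
-- columns; then every vertex lies in one part P of π (each vertex is in a different
-- column from one of the two), and within a column b is again constant, so
-- (a, c) is injective with a ∈ P and there are at most n·|P| = n·r/k of them.
-- Both bounds are attained: a full column, and P × [n] at a fixed b.
module Submission where

open import Defs
open import Data.Nat using (ℕ; suc; _≤_; _⊔_; _*_; _/_; NonZero; z≤n; s≤s; _+_; _≤?_)
open import Data.Nat.Divisibility using (_∣_)
open import Data.Nat.DivMod using (*-/-assoc)
open import Data.Nat.Properties
  using (≤-trans; m≤m⊔n; m≤n⊔m; m≤n⇒m⊔n≡n; m≥n⇒m⊔n≡m; ≰⇒≥)
open import Data.Fin using (Fin; zero; _≟_)
open import Data.Product using (_,_; proj₁; proj₂)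
open import Data.Sum using (_⊎_; inj₁; inj₂)
open import Data.List using (List; []; _∷_; length; filter; allFin; map; cartesianProduct)
open import Data.List.Properties using (length-map; length-++; length-tabulate; length-removeAt′)
open import Data.List.Relation.Unary.Unique.Propositional using (Unique)
import Data.List.Relation.Unary.Unique.Propositional.Properties as Unique
open import Data.List.Relation.Unary.AllPairs using (_∷_)
import Data.List.Relation.Unary.All as All
open import Data.List.Relation.Unary.Any using (here; there; _─_; any?)
open import Data.List.Membership.Propositional using (_∈_; find; lose)
open import Data.List.Membership.Propositional.Properties
  using (∈-map⁻; ∈-filter⁺; ∈-filter⁻; ∈-allFin; ∈-cartesianProduct⁺; ∈-cartesianProduct⁻)
open import Relation.Binary.PropositionalEquality using (_≡_; _≢_; refl; sym; trans; cong; cong₂; subst)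
open import Relation.Nullary using (¬_; yes; no; ¬?)
open import Data.Empty using (⊥-elim)

private
  variable
    A B : Set

∈-─⁺ : ∀ {x z : A} {ys : List A} (x∈ys : x ∈ ys) → z ∈ ys → z ≢ x → z ∈ (ys ─ x∈ys)
∈-─⁺ (here refl)  (here refl)  z≢x = ⊥-elim (z≢x refl)
∈-─⁺ (here _)     (there z∈ys) _   = z∈ys
∈-─⁺ (there _)    (here z≡y)   _   = here z≡y
∈-─⁺ (there x∈ys) (there z∈ys) z≢x = there (∈-─⁺ x∈ys z∈ys z≢x)

injectiveOn⇒length≤ : (f : A → B) (xs : List A) (ys : List B) → Unique xs
  → (∀ {x y} → x ∈ xs → y ∈ xs → f x ≡ f y → x ≡ y)
  → (∀ {x} → x ∈ xs → f x ∈ ys) → length xs ≤ length ys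
injectiveOn⇒length≤ f []       ys _             _   _    = z≤n
injectiveOn⇒length≤ f (x ∷ xs) ys (x∉xs ∷ uxs) inj into =
  subst (suc (length xs) ≤_) (sym (length-removeAt′ ys _))
    (s≤s (injectiveOn⇒length≤ f xs (ys ─ fx∈ys) uxs
      (λ x∈ y∈ → inj (there x∈) (there y∈))
      (λ y∈xs → ∈-─⁺ fx∈ys (into (there y∈xs))
        (λ fy≡fx → All.lookup x∉xs y∈xs (inj (here refl) (there y∈xs) (sym fy≡fx))))))
  where
  fx∈ys : f x ∈ ys
  fx∈ys = into (here refl)

length-cartesianProduct : (xs : List A) (ys : List B)
  → length (cartesianProduct xs ys) ≡ length xs * length ys
length-cartesianProduct []       ys = refl
length-cartesianProduct (x ∷ xs) ys =
  trans (length-++ (map (x ,_) ys)) (cong₂ _+_ (length-map (x ,_) ys) (length-cartesianProduct xs ys))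

length-allFin : ∀ n → length (allFin n) ≡ n
length-allFin n = length-tabulate (λ i → i)

module _ {r k m n : ℕ} (part : Fin r → Fin k) where

  aOf : Vertex r m n → Fin r
  aOf (a , _ , _) = a

  bOf : Vertex r m n → Fin m
  bOf (_ , b , _) = b

  cOf : Vertex r m n → Fin n
  cOf (_ , _ , c) = c

  PartMembers : Fin k → List (Fin r)
  PartMembers i = filter (λ a → part a ≟ i) (allFin r)

  ∈-PartMembers⁻ : ∀ {a i} → a ∈ PartMembers i → part a ≡ i
  ∈-PartMembers⁻ {i = i} a∈ = proj₂ (∈-filter⁻ (λ a → part a ≟ i) {xs = allFin r} a∈)

  ¬Adj-intro : ∀ {x y : Vertex r m n} → bOf x ≡ bOf y
    → (cOf x ≢ cOf y → part (aOf x) ≡ part (aOf y)) → ¬ Adj part x y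
  ¬Adj-intro b≡ _      (inj₁ (_ , b≢))   = b≢ b≡
  ¬Adj-intro _  sameP  (inj₂ (c≢ , p≢)) = p≢ (sameP c≢)

  module Independent {S : List (Vertex r m n)} (ind : IsIndependent part S) where

    sameColumn⇒sameB : ∀ {x y} → x ∈ S → y ∈ S → cOf x ≡ cOf y → bOf x ≡ bOf y
    sameColumn⇒sameB {x} {y} x∈ y∈ c≡ with bOf x ≟ bOf y
    ... | yes b≡ = b≡
    ... | no  b≢ = ⊥-elim (proj₂ ind x∈ y∈ (inj₁ (c≡ , b≢)))

    otherColumn⇒samePart : ∀ {x y} → x ∈ S → y ∈ S → cOf x ≢ cOf y → part (aOf x) ≡ part (aOf y)
    otherColumn⇒samePart {x} {y} x∈ y∈ c≢ with part (aOf x) ≟ part (aOf y)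
    ... | yes p≡ = p≡
    ... | no  p≢ = ⊥-elim (proj₂ ind x∈ y∈ (inj₂ (c≢ , p≢)))

    oneColumn⇒length≤ : ∀ c → (∀ {x} → x ∈ S → cOf x ≡ c) → length S ≤ r
    oneColumn⇒length≤ c inColumn = subst (length S ≤_) (length-allFin r)
      (injectiveOn⇒length≤ aOf S (allFin r) (proj₁ ind) inj (λ {x} _ → ∈-allFin (aOf x)))
      where
      inj : ∀ {x y} → x ∈ S → y ∈ S → aOf x ≡ aOf y → x ≡ y
      inj {_ , _ , _} {_ , _ , _} x∈ y∈ refl with inColumn x∈ | inColumn y∈
      ... | refl | refl with sameColumn⇒sameB x∈ y∈ refl
      ... | refl = refl

    onePart⇒length≤ : ∀ i → (∀ {x} → x ∈ S → part (aOf x) ≡ i)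
      → length S ≤ n * PartSize part i
    onePart⇒length≤ i inPart = subst (length S ≤_)
      (trans (length-cartesianProduct (allFin n) (PartMembers i)) (cong₂ _*_ (length-allFin n) refl))
      (injectiveOn⇒length≤ (λ x → cOf x , aOf x) S _ (proj₁ ind) inj
        (λ {x} x∈ → ∈-cartesianProduct⁺ (∈-allFin (cOf x))
                      (∈-filter⁺ (λ a → part a ≟ i) (∈-allFin (aOf x)) (inPart x∈))))
      where
      inj : ∀ {x y} → x ∈ S → y ∈ S → (cOf x , aOf x) ≡ (cOf y , aOf y) → x ≡ y
      inj {_ , _ , _} {_ , _ , _} x∈ y∈ refl with sameColumn⇒sameB x∈ y∈ refl
      ... | refl = refl

    oneColumn⊎onePart : ∀ {x₀} → x₀ ∈ S
      → (∀ {x} → x ∈ S → cOf x ≡ cOf x₀) ⊎ (∀ {x} → x ∈ S → part (aOf x) ≡ part (aOf x₀))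
    oneColumn⊎onePart {x₀} x₀∈ with any? (λ y → ¬? (cOf y ≟ cOf x₀)) S
    ... | no noOther = inj₁ inColumn
      where
      inColumn : ∀ {x} → x ∈ S → cOf x ≡ cOf x₀
      inColumn {x} x∈ with cOf x ≟ cOf x₀
      ... | yes c≡ = c≡
      ... | no  c≢ = ⊥-elim (noOther (lose x∈ c≢))
    ... | yes other with find other
    ... | y , y∈ , cy≢ = inj₂ inPart
      where
      inPart : ∀ {x} → x ∈ S → part (aOf x) ≡ part (aOf x₀)
      inPart {x} x∈ with cOf x ≟ cOf x₀
      ... | no  c≢ = otherColumn⇒samePart x∈ x₀∈ c≢
      ... | yes c≡ = trans (otherColumn⇒samePart x∈ y∈ (λ c≡y → cy≢ (trans (sym c≡y) c≡)))
                           (otherColumn⇒samePart y∈ x₀∈ cy≢)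

  independent⇒length≤ : ∀ {s} → EqualPartition r k part s
    → ∀ S → IsIndependent part S → length S ≤ r ⊔ n * s
  independent⇒length≤ equal []       _ = z≤n
  independent⇒length≤ {s} equal (x₀ ∷ S) ind with Independent.oneColumn⊎onePart ind (here refl)
  ... | inj₁ inColumn = ≤-trans (Independent.oneColumn⇒length≤ ind _ inColumn) (m≤m⊔n r (n * s))
  ... | inj₂ inPart   = ≤-trans (subst (λ t → length (x₀ ∷ S) ≤ n * t) (equal _)
                                   (Independent.onePart⇒length≤ ind _ inPart))
                                 (m≤n⊔m r (n * s))

  column : Fin m → Fin n → List (Vertex r m n)
  column b c = map (λ a → a , b , c) (allFin r)

  column-independent : ∀ b c → IsIndependent part (column b c)
  column-independent b c =
    Unique.map⁺ (cong aOf) (Unique.allFin⁺ r) , nonAdjacent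
    where
    nonAdjacent : ∀ {x y} → x ∈ column b c → y ∈ column b c → ¬ Adj part x y
    nonAdjacent x∈ y∈ with ∈-map⁻ _ x∈ | ∈-map⁻ _ y∈
    ... | _ , _ , refl | _ , _ , refl = ¬Adj-intro refl (λ c≢c → ⊥-elim (c≢c refl))

  length-column : ∀ b c → length (column b c) ≡ r
  length-column b c = trans (length-map _ (allFin r)) (length-allFin r)

  partLayer : Fin m → Fin k → List (Vertex r m n)
  partLayer b i = map (λ (c , a) → a , b , c) (cartesianProduct (allFin n) (PartMembers i))

  partLayer-independent : ∀ b i → IsIndependent part (partLayer b i)
  partLayer-independent b i =
    Unique.map⁺ (λ { refl → refl })
      (Unique.cartesianProduct⁺ (Unique.allFin⁺ n) (Unique.filter⁺ (λ a → part a ≟ i) (Unique.allFin⁺ r)))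
    , nonAdjacent
    where
    inPart : ∀ {x} → x ∈ partLayer b i → part (aOf x) ≡ i
    inPart x∈ with ∈-map⁻ _ x∈
    ... | _ , ca∈ , refl = ∈-PartMembers⁻ (proj₂ (∈-cartesianProduct⁻ (allFin n) (PartMembers i) ca∈))
    nonAdjacent : ∀ {x y} → x ∈ partLayer b i → y ∈ partLayer b i → ¬ Adj part x y
    nonAdjacent x∈ y∈ with ∈-map⁻ _ x∈ | ∈-map⁻ _ y∈
    ... | _ , _ , refl | _ , _ , refl = ¬Adj-intro refl (λ _ → trans (inPart x∈) (sym (inPart y∈)))

  length-partLayer : ∀ {s} → EqualPartition r k part s → ∀ b i → length (partLayer b i) ≡ n * s
  length-partLayer equal b i =
    trans (length-map _ (cartesianProduct (allFin n) (PartMembers i)))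
      (trans (length-cartesianProduct (allFin n) (PartMembers i)) (cong₂ _*_ (length-allFin n) (equal i)))

  independenceNumber : ∀ {s} → EqualPartition r k part s → Fin m → Fin n → Fin k
    → IndependenceNumberIs part m n (r ⊔ n * s)
  independenceNumber {s} equal b c i with r ≤? n * s
  ... | yes r≤ns = (partLayer b i , partLayer-independent b i ,
                     trans (length-partLayer equal b i) (sym (m≤n⇒m⊔n≡n r≤ns)))
                 , independent⇒length≤ equal
  ... | no  r≰ns = (column b c , column-independent b c ,
                     trans (length-column b c) (sym (m≥n⇒m⊔n≡m (≰⇒≥ r≰ns))))
                 , independent⇒length≤ equal

corollary3p5 : (m n k r : ℕ) → 2 ≤ m → 2 ≤ n → 1 ≤ k → 1 ≤ r
    → .{{_ : NonZero k}} → k ∣ r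
    → (part : Fin r → Fin k) → EqualPartition r k part (r / k)
    → IndependenceNumberIs part m n (r ⊔ ((n * r) / k))
corollary3p5 m n k r (s≤s _) (s≤s _) (s≤s _) _ k∣r part equal =
  subst (IndependenceNumberIs part m n) (cong (r ⊔_) (sym (*-/-assoc n k∣r)))
    (independenceNumber part equal zero zero zero)
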